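{- Let $S$ be a finite subset of $\mathbb{N}=\{1,2,3,\dots\}$. The following are equivalent: (1) there exist finite digraphs $G$, $H$ and a mapping $f:E(G)\to E(H)$ such that $S=FF(f,G,H)$; (2) there is $n\in\mathbb{N}$ such that $S$ is the set of all positive divisors of $n$.
   Context: Digraphs are finite multidigraphs; loops and parallel edges are allowed. For an abelian group $M$, a map $\varphi:E(G)\to M$ is an $M$-flow if at every vertex $v$ the sum of $\varphi$ over edges leaving $v$ equals the sum of $\varphi$ over edges entering $v$. A mapping $f:E(G)\to E(H)$ is $M$-flow-continuous if for every $M$-flow $\varphi$ on $H$ the composition $\varphi\circ f$ is an $M$-flow on $G$. For a mapping $f:E(G)\to E(H)$, we set $FF(f,G,H)=\{n\ge 1: f \text{ is } \mathbb{Z}_n\text{ -flow-continuous}\}$. -}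

module Defs where

open import Data.Nat using (ℕ; _%_; NonZero)
open import Data.Fin using (Fin; toℕ; _≟_)
open import Data.List using (List; map; allFin)
open import Data.Nat.ListAction using (sum)
open import Data.Bool using (if_then_else_)
open import Data.Product using (Σ)
open import Relation.Nullary.Decidable using (⌊_⌋)
open import Relation.Binary.PropositionalEquality using (_≡_)

-- A finite multidigraph: finitely many vertices and edges, each edge has a
-- tail (source) and a head (target).  Loops and parallel edges are allowed.
record Digraph : Set where
  field
    nV   : ℕ
    nE   : ℕ
    tail : Fin nE → Fin nV
    head : Fin nE → Fin nV
open Digraph public

outSum : (G : Digraph) → (Fin (nE G) → ℕ) → Fin (nV G) → ℕ
outSum G ψ v = sum (map (λ e → if ⌊ tail G e ≟ v ⌋ then ψ e else 0) (allFin (nE G)))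

inSum : (G : Digraph) → (Fin (nE G) → ℕ) → Fin (nV G) → ℕ
inSum G ψ v = sum (map (λ e → if ⌊ head G e ≟ v ⌋ then ψ e else 0) (allFin (nE G)))

-- φ : E(G) → ℤ_n (elements of ℤ_n represented by Fin n) is a ℤ_n-flow
IsZnFlow : (n : ℕ) .{{_ : NonZero n}} (G : Digraph) → (Fin (nE G) → Fin n) → Set
IsZnFlow n G φ = ∀ v → outSum G (λ e → toℕ (φ e)) v % n ≡ inSum G (λ e → toℕ (φ e)) v % n

FlowContinuous : (n : ℕ) .{{_ : NonZero n}} (G H : Digraph) → (Fin (nE G) → Fin (nE H)) → Set
FlowContinuous n G H f = (φ : Fin (nE H) → Fin n) → IsZnFlow n H φ → IsZnFlow n G (λ e → φ (f e))

InFF : (G H : Digraph) → (Fin (nE G) → Fin (nE H)) → ℕ → Set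
InFF G H f n = Σ (NonZero n) (λ nz → FlowContinuous n {{nz}} G H f)

-- FF(f,G,H) is closed under divisors and under lcm.  Divisors: multiplying by c embeds
-- ℤ_k into ℤ_(ck), maps flows to flows, and is injective on residues, so ℤ_(ck)-continuity
-- gives ℤ_k-continuity.  Lcm: reducing a ℤ_n-flow mod each member k of S (all dividing n)
-- gives ℤ_k-flows, so the out- and in-sums of the pulled-back map agree mod every k, hence
-- mod lcm S.  A finite FF is therefore exactly the set of divisors of its lcm.  Conversely,
-- n parallel edges mapped onto a single loop pull a value x back to net flow n·x at each
-- vertex, so their FF is the set of divisors of n.

module Submission where

open import Defs
open import Data.Nat
  using (ℕ; zero; suc; _≤_; _+_; _∸_; _*_; _/_; _%_; ∣_-_∣; NonZero; ≢-nonZero; ≢-nonZero⁻¹; >-nonZero; >-nonZero⁻¹)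
open import Data.Nat.Properties hiding (_≟_)
open import Data.Nat.DivMod using (m≡m%n+[m/n]*n; m∣n⇒o%n%m≡o%m; %-distribˡ-+; %-remove-+ʳ; m%n%n≡m%n; m%n<n)
open import Data.Nat.Divisibility
open import Data.Nat.LCM using (lcm; m∣lcm[m,n]; n∣lcm[m,n]; lcm-least)
open import Data.Nat.ListAction using (sum)
open import Data.Fin using (Fin; toℕ; fromℕ<; zero; suc; _≟_)
open import Data.Fin.Properties using (toℕ-fromℕ<; toℕ<n)
open import Data.List using (List; []; _∷_; map; allFin; foldr; length)
open import Data.List.Properties using (map-cong; length-tabulate)
open import Data.List.Relation.Unary.All using (All; []; _∷_; lookup) renaming (map to All-map)
open import Data.List.Relation.Unary.Any using (here; there)
open import Data.List.Membership.Propositional using (_∈_)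
open import Data.Bool using (Bool; true; false; if_then_else_)
open import Data.Product using (Σ; _×_; _,_)
open import Data.Sum using ([_,_]′)
open import Function.Base using (_∘_; id)
open import Function.Bundles using (_⇔_; mk⇔; Equivalence)
open import Relation.Nullary.Decidable using (⌊_⌋)
open import Relation.Binary.PropositionalEquality

infix 4 _≡_mod_

_≡_mod_ : ℕ → ℕ → (n : ℕ) → .{{NonZero n}} → Set
a ≡ b mod n = a % n ≡ b % n

module _ {n : ℕ} .{{_ : NonZero n}} where

  mod⇒∣∣-∣ : ∀ a b → a ≡ b mod n → n ∣ ∣ a - b ∣
  mod⇒∣∣-∣ a b a≡b = divides ∣ a / n - b / n ∣ (begin
    ∣ a - b ∣                                   ≡⟨ cong₂ ∣_-_∣ (m≡m%n+[m/n]*n a n) (m≡m%n+[m/n]*n b n) ⟩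
    ∣ a % n + a / n * n - b % n + b / n * n ∣   ≡⟨ cong (λ r → ∣ a % n + a / n * n - r + b / n * n ∣) (sym a≡b) ⟩
    ∣ a % n + a / n * n - a % n + b / n * n ∣   ≡⟨ ∣m+n-m+o∣≡∣n-o∣ (a % n) _ _ ⟩
    ∣ a / n * n - b / n * n ∣                   ≡⟨ *-distribʳ-∣-∣ n (a / n) (b / n) ⟨
    ∣ a / n - b / n ∣ * n                       ∎)
    where open ≡-Reasoning

  ∣∣-∣⇒mod : ∀ a b → n ∣ ∣ a - b ∣ → a ≡ b mod n
  ∣∣-∣⇒mod a b n∣∣a-b∣ =
    [ (λ a≤b → ordered a≤b n∣∣a-b∣)
    , (λ b≤a → sym (ordered b≤a (subst (n ∣_) (∣-∣-comm a b) n∣∣a-b∣)))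
    ]′ (≤-total a b)
    where
    ordered : ∀ {a b} → a ≤ b → n ∣ ∣ a - b ∣ → a ≡ b mod n
    ordered {a} {b} a≤b n∣∣a-b∣ = begin
      a % n                ≡⟨ %-remove-+ʳ a n∣∣a-b∣ ⟨
      (a + ∣ a - b ∣) % n  ≡⟨ cong (λ d → (a + d) % n) (m≤n⇒∣m-n∣≡n∸m a≤b) ⟩
      (a + (b ∸ a)) % n    ≡⟨ cong (_% n) (m+[n∸m]≡n a≤b) ⟩
      b % n                ∎
      where open ≡-Reasoning

mod-∣ : ∀ {a b d n} .{{_ : NonZero d}} .{{_ : NonZero n}} → d ∣ n → a ≡ b mod n → a ≡ b mod d
mod-∣ {a} {b} {d} {n} d∣n a≡b = begin
  a % d      ≡⟨ m∣n⇒o%n%m≡o%m d n a d∣n ⟨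
  a % n % d  ≡⟨ cong (_% d) a≡b ⟩
  b % n % d  ≡⟨ m∣n⇒o%n%m≡o%m d n b d∣n ⟩
  b % d      ∎
  where open ≡-Reasoning

mod-*ˡ : ∀ {a b n} c .{{_ : NonZero n}} .{{_ : NonZero (c * n)}} → a ≡ b mod n → c * a ≡ c * b mod (c * n)
mod-*ˡ {a} {b} c a≡b =
  ∣∣-∣⇒mod _ _ (subst (c * _ ∣_) (*-distribˡ-∣-∣ c a b) (*-monoʳ-∣ c (mod⇒∣∣-∣ a b a≡b)))

mod-*ˡ⁻¹ : ∀ {a b n} c .{{_ : NonZero c}} .{{_ : NonZero n}} .{{_ : NonZero (c * n)}} →
           c * a ≡ c * b mod (c * n) → a ≡ b mod n
mod-*ˡ⁻¹ {a} {b} c ca≡cb =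
  ∣∣-∣⇒mod a b (*-cancelˡ-∣ c (subst (c * _ ∣_) (sym (*-distribˡ-∣-∣ c a b)) (mod⇒∣∣-∣ _ _ ca≡cb)))

∣-nonZero : ∀ {m n} .{{_ : NonZero n}} → m ∣ n → NonZero m
∣-nonZero {n = n} m∣n = ≢-nonZero λ { refl → ≢-nonZero⁻¹ n (0∣⇒≡0 m∣n) }

lcmList : List ℕ → ℕ
lcmList = foldr lcm 1

∈⇒∣lcmList : ∀ {k} S → k ∈ S → k ∣ lcmList S
∈⇒∣lcmList (k ∷ S) (here refl) = m∣lcm[m,n] k (lcmList S)
∈⇒∣lcmList (m ∷ S) (there k∈S) = ∣-trans (∈⇒∣lcmList S k∈S) (n∣lcm[m,n] m (lcmList S))

lcmList-least : ∀ {n} S → (∀ {k} → k ∈ S → k ∣ n) → lcmList S ∣ n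
lcmList-least []      _     = 1∣ _
lcmList-least (m ∷ S) S∣n = lcm-least (S∣n (here refl)) (lcmList-least S (S∣n ∘ there))

lcmList-nonZero : ∀ S → All NonZero S → NonZero (lcmList S)
lcmList-nonZero []      []         = _
lcmList-nonZero (m ∷ S) (m≢0 ∷ S≢0) = ∣-nonZero {{m*n≢0 m (lcmList S) {{m≢0}} {{lcmList-nonZero S S≢0}}}}
  (lcm-least (m∣m*n {m} (lcmList S)) (n∣m*n m))

sum-map-*ˡ : ∀ {A : Set} c (g : A → ℕ) xs → sum (map (λ x → c * g x) xs) ≡ c * sum (map g xs)
sum-map-*ˡ c g []       = sym (*-zeroʳ c)
sum-map-*ˡ c g (x ∷ xs) = trans (cong (c * g x +_) (sum-map-*ˡ c g xs)) (sym (*-distribˡ-+ c (g x) _))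

sum-map-mod : ∀ {A : Set} {d} .{{_ : NonZero d}} {g h : A → ℕ} →
              (∀ x → g x ≡ h x mod d) → ∀ xs → sum (map g xs) ≡ sum (map h xs) mod d
sum-map-mod g≡h []                         = refl
sum-map-mod {d = d} {g} {h} g≡h (x ∷ xs) = begin
  (g x + sum (map g xs)) % d            ≡⟨ %-distribˡ-+ (g x) _ d ⟩
  (g x % d + sum (map g xs) % d) % d    ≡⟨ cong₂ (λ a b → (a + b) % d) (g≡h x) (sum-map-mod g≡h xs) ⟩
  (h x % d + sum (map h xs) % d) % d    ≡⟨ %-distribˡ-+ (h x) _ d ⟨
  (h x + sum (map h xs)) % d            ∎
  where open ≡-Reasoning

sum-map-const : ∀ {A : Set} x (xs : List A) → sum (map (λ _ → x) xs) ≡ length xs * x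
sum-map-const x []       = refl
sum-map-const x (_ ∷ xs) = cong (x +_) (sum-map-const x xs)

restrictedSum : ∀ {m} → (Fin m → Bool) → (Fin m → ℕ) → ℕ
restrictedSum p w = sum (map (λ e → if p e then w e else 0) (allFin _))

restrictedSum-*ˡ : ∀ {m} (p : Fin m → Bool) w c → restrictedSum p (λ e → c * w e) ≡ c * restrictedSum p w
restrictedSum-*ˡ p w c =
  trans (cong sum (map-cong (λ e → termwise (p e)) (allFin _)))
        (sum-map-*ˡ c (λ e → if p e then w e else 0) (allFin _))
  where
  termwise : ∀ b {x} → (if b then c * x else 0) ≡ c * (if b then x else 0)
  termwise true  = refl
  termwise false = sym (*-zeroʳ c)

restrictedSum-mod : ∀ {m n} .{{_ : NonZero n}} (p : Fin m → Bool) {w w'} →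
                    (∀ e → w e ≡ w' e mod n) → restrictedSum p w ≡ restrictedSum p w' mod n
restrictedSum-mod {n = n} p w≡w' = sum-map-mod (λ e → termwise (p e) (w≡w' e)) (allFin _)
  where
  termwise : ∀ b {x y} → x ≡ y mod n → (if b then x else 0) ≡ (if b then y else 0) mod n
  termwise true  x≡y = x≡y
  termwise false _   = refl

Balanced : (n : ℕ) .{{_ : NonZero n}} (G : Digraph) → (Fin (nE G) → ℕ) → Set
Balanced n G w = ∀ v → outSum G w v ≡ inSum G w v mod n

module _ (G : Digraph) where

  private
    leaving entering : Fin (nV G) → Fin (nE G) → Bool
    leaving  v e = ⌊ tail G e ≟ v ⌋
    entering v e = ⌊ head G e ≟ v ⌋

  Balanced-cong-mod : ∀ {n} .{{_ : NonZero n}} {w w'} →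
                      (∀ e → w e ≡ w' e mod n) → Balanced n G w → Balanced n G w'
  Balanced-cong-mod w≡w' bal v = trans (sym (restrictedSum-mod (leaving v) w≡w'))
                                   (trans (bal v) (restrictedSum-mod (entering v) w≡w'))

  Balanced-∣ : ∀ {d n} .{{_ : NonZero d}} .{{_ : NonZero n}} {w} → d ∣ n → Balanced n G w → Balanced d G w
  Balanced-∣ d∣n bal v = mod-∣ d∣n (bal v)

  Balanced-*ˡ : ∀ {n} c .{{_ : NonZero n}} .{{_ : NonZero (c * n)}} {w} →
                Balanced n G w → Balanced (c * n) G (λ e → c * w e)
  Balanced-*ˡ {n} c {w} bal v =
    subst₂ (λ a b → a ≡ b mod (c * n))
      (sym (restrictedSum-*ˡ (leaving v) w c)) (sym (restrictedSum-*ˡ (entering v) w c)) (mod-*ˡ c (bal v))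

  Balanced-*ˡ⁻¹ : ∀ {n} c .{{_ : NonZero c}} .{{_ : NonZero n}} .{{_ : NonZero (c * n)}} {w} →
                  Balanced (c * n) G (λ e → c * w e) → Balanced n G w
  Balanced-*ˡ⁻¹ {n} c {w} bal v =
    mod-*ˡ⁻¹ c (subst₂ (λ a b → a ≡ b mod (c * n))
                  (restrictedSum-*ˡ (leaving v) w c) (restrictedSum-*ˡ (entering v) w c) (bal v))

reduce : ∀ {n} d .{{_ : NonZero d}} → Fin n → Fin d
reduce d x = fromℕ< (m%n<n (toℕ x) d)

toℕ-reduce : ∀ {n} d .{{_ : NonZero d}} (x : Fin n) → toℕ (reduce d x) ≡ toℕ x mod d
toℕ-reduce d x = trans (cong (_% d) (toℕ-fromℕ< _)) (m%n%n≡m%n (toℕ x) d)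

scale : ∀ {n} c .{{_ : NonZero c}} → Fin n → Fin (c * n)
scale c x = fromℕ< (*-monoʳ-< c (toℕ<n x))

toℕ-scale : ∀ {n} c .{{_ : NonZero c}} (x : Fin n) → toℕ (scale c x) ≡ c * toℕ x
toℕ-scale c x = toℕ-fromℕ< _

module _ (G H : Digraph) (f : Fin (nE G) → Fin (nE H)) where

  FlowContinuous-*ˡ⁻¹ : ∀ {n} c .{{_ : NonZero c}} .{{_ : NonZero n}} .{{_ : NonZero (c * n)}} →
                        FlowContinuous (c * n) G H f → FlowContinuous n G H f
  FlowContinuous-*ˡ⁻¹ {n} c fc φ φ-flow =
    Balanced-*ˡ⁻¹ G c (Balanced-cong-mod G (λ e → cong (_% _) (toℕ-scale c (φ (f e)))) (fc (scale c ∘ φ) scaled-flow))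
    where
    scaled-flow : IsZnFlow (c * n) H (scale c ∘ φ)
    scaled-flow = Balanced-cong-mod H (λ e → cong (_% _) (sym (toℕ-scale c (φ e)))) (Balanced-*ˡ H c φ-flow)

  FlowContinuous-∣ : ∀ {k n} .{{_ : NonZero k}} .{{_ : NonZero n}} →
                     k ∣ n → FlowContinuous n G H f → FlowContinuous k G H f
  FlowContinuous-∣ (divides q refl) = FlowContinuous-*ˡ⁻¹ q {{m*n≢0⇒m≢0 q}}

  FlowContinuous⇒Balanced-∣ : ∀ {d n} .{{_ : NonZero d}} .{{_ : NonZero n}} → d ∣ n → FlowContinuous d G H f →
                              (φ : Fin (nE H) → Fin n) → IsZnFlow n H φ → Balanced d G (toℕ ∘ φ ∘ f)
  FlowContinuous⇒Balanced-∣ {d} d∣n fc φ φ-flow =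
    Balanced-cong-mod G (λ e → toℕ-reduce d (φ (f e))) (fc (reduce d ∘ φ) reduced-flow)
    where
    reduced-flow : IsZnFlow d H (reduce d ∘ φ)
    reduced-flow = Balanced-cong-mod H (λ e → sym (toℕ-reduce d (φ e))) (Balanced-∣ H d∣n φ-flow)

  FlowContinuous-lcmList : ∀ S .{{_ : NonZero (lcmList S)}} → (∀ {k} → k ∈ S → InFF G H f k) →
                           FlowContinuous (lcmList S) G H f
  FlowContinuous-lcmList S S⊆FF φ φ-flow v = ∣∣-∣⇒mod _ _ (lcmList-least S divides-difference)
    where
    divides-difference : ∀ {k} → k ∈ S → k ∣ ∣ outSum G (toℕ ∘ φ ∘ f) v - inSum G (toℕ ∘ φ ∘ f) v ∣
    divides-difference k∈S with S⊆FF k∈S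
    ... | k≢0 , fc = mod⇒∣∣-∣ {{k≢0}} _ _ (FlowContinuous⇒Balanced-∣ {{k≢0}} (∈⇒∣lcmList S k∈S) fc φ φ-flow v)

parallelEdges : ℕ → Digraph
parallelEdges n = record { nV = 2 ; nE = n ; tail = λ _ → zero ; head = λ _ → suc zero }

loop : Digraph
loop = record { nV = 1 ; nE = 1 ; tail = λ _ → zero ; head = λ _ → zero }

collapse : ∀ n → Fin n → Fin 1
collapse n _ = zero

Balanced-parallelEdges : ∀ {k} .{{_ : NonZero k}} n x → Balanced k (parallelEdges n) (λ _ → x) ⇔ k ∣ n * x
Balanced-parallelEdges {k} n x = mk⇔
  (λ bal → subst (k ∣_) out-in (mod⇒∣∣-∣ _ _ (bal zero)))
  (λ k∣nx → let out≡in = ∣∣-∣⇒mod _ _ (subst (k ∣_) (sym out-in) k∣nx) in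
            λ { zero → out≡in ; (suc zero) → sym out≡in })
  where
  sum-const : ∀ y → sum (map (λ _ → y) (allFin n)) ≡ n * y
  sum-const y = trans (sum-map-const y (allFin n)) (cong (_* y) (length-tabulate {n = n} id))

  out-in : ∣ sum (map (λ _ → x) (allFin n)) - sum (map (λ _ → 0) (allFin n)) ∣ ≡ n * x
  out-in = trans (cong₂ ∣_-_∣ (sum-const x) (trans (sum-const 0) (*-zeroʳ n))) (∣-∣-identityʳ (n * x))

FlowContinuous-collapse : ∀ n k .{{_ : NonZero k}} → FlowContinuous k (parallelEdges n) loop (collapse n) ⇔ k ∣ n
FlowContinuous-collapse n k = mk⇔ (divides-n k) λ k∣n φ _ →
  Equivalence.from (Balanced-parallelEdges n (toℕ (φ zero))) (∣m⇒∣m*n _ k∣n)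
  where
  -- Every map on the loop is a flow; the constant 1 (absent from ℤ_1) forces k ∣ n.
  divides-n : ∀ k .{{_ : NonZero k}} → FlowContinuous k (parallelEdges n) loop (collapse n) → k ∣ n
  divides-n (suc zero)    _  = 1∣ n
  divides-n (suc (suc _)) fc = subst (_ ∣_) (*-identityʳ n)
    (Equivalence.to (Balanced-parallelEdges n 1) (fc (λ _ → suc zero) (λ _ → refl)))

FF-divisors-of-lcmList : ∀ S → All NonZero S → ∀ G H f → (∀ k → k ∈ S ⇔ InFF G H f k) →
                         ∀ k → k ∈ S ⇔ k ∣ lcmList S
FF-divisors-of-lcmList S S≢0 G H f S⇔FF k = mk⇔ (∈⇒∣lcmList S) λ k∣lcm →
  let instance k≢0 = ∣-nonZero k∣lcm
  in Equivalence.from (S⇔FF k)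
       (k≢0 , FlowContinuous-∣ G H f k∣lcm (FlowContinuous-lcmList G H f S (Equivalence.to (S⇔FF _))))
  where instance _ = lcmList-nonZero S S≢0

collapse-FF-divisors : ∀ S n → All NonZero S → (∀ k → k ∈ S ⇔ k ∣ n) →
                       ∀ k → k ∈ S ⇔ InFF (parallelEdges n) loop (collapse n) k
collapse-FF-divisors S n S≢0 S⇔∣n k = mk⇔
  (λ k∈S → let instance k≢0 = lookup S≢0 k∈S
           in k≢0 , Equivalence.from (FlowContinuous-collapse n k) (Equivalence.to (S⇔∣n k) k∈S))
  (λ (k≢0 , fc) → Equivalence.from (S⇔∣n k) (Equivalence.to (FlowContinuous-collapse n k {{k≢0}}) fc))

theorem2p6 : (S : List ℕ) → All (1 ≤_) S →
    (Σ Digraph (λ G → Σ Digraph (λ H → Σ (Fin (nE G) → Fin (nE H)) (λ f →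
        ∀ k → (k ∈ S) ⇔ InFF G H f k))))
    ⇔
    (Σ ℕ (λ n → 1 ≤ n × (∀ k → (k ∈ S) ⇔ (k ∣ n))))
theorem2p6 S S⁺ = mk⇔
  (λ (G , H , f , S⇔FF) → lcmList S , >-nonZero⁻¹ (lcmList S) {{lcmList-nonZero S S≢0}} ,
                            FF-divisors-of-lcmList S S≢0 G H f S⇔FF)
  (λ (n , _ , S⇔∣n) → parallelEdges n , loop , collapse n , collapse-FF-divisors S n S≢0 S⇔∣n)
  where
  S≢0 : All NonZero S
  S≢0 = All-map >-nonZero S⁺
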